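{- For every $n\ge 1$ and every $s\in\{1,\dots,n\}$ there exist a two-fold MDS code $M\subseteq Q_4^n$ and a latin bitrade $B\subseteq Q_4^n$ with $|B|=2^{n+1}-2^s$ such that $B$ is embeddable into $M$, i.e. there is a two-fold MDS code $M'\subseteq Q_4^n$ with $B=M\triangle M'$.
   Context: Let $Q_k=\{0,1,\dots,k-1\}$ and $Q_k^n$ the set of words of length $n$ over $Q_k$. A one-dimensional face of direction $i$ through $(a_1,\dots,a_n)$ is $\{(a_1,\dots,a_{i-1},x,a_{i+1},\dots,a_n): x\in Q_k\}$. A set $B\subseteq Q_k^n$ is a latin bitrade if $|B\cap F|\in\{0,2\}$ for every one-dimensional face $F$. A set $W\subseteq Q_k^n$ is a $t$-fold MDS code if $|W\cap F|=t$ for every one-dimensional face $F$. A latin bitrade $B$ is embeddable into a $t$-fold MDS code $M_1$ if there is a $t$-fold MDS code $M_2$ with $B=M_1\triangle M_2$. -}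

module Defs where

open import Data.Nat using (ℕ; zero; suc)
open import Data.Fin using (Fin)
open import Data.Bool using (Bool; true; false; _xor_)
open import Data.Vec using (Vec; []; _∷_; _[_]≔_)
open import Data.List using (List; []; _∷_; map; concatMap; allFin; length; filterᵇ)
open import Relation.Binary.PropositionalEquality using (_≡_)
open import Data.Sum using (_⊎_)

Word : ℕ → ℕ → Set
Word k n = Vec (Fin k) n

Subset : ℕ → ℕ → Set
Subset k n = Word k n → Bool

allWords : (k n : ℕ) → List (Word k n)
allWords k zero = [] ∷ []
allWords k (suc n) = concatMap (λ x → map (x ∷_) (allWords k n)) (allFin k)

card : ∀ {k n} → Subset k n → ℕ
card {k} {n} S = length (filterᵇ S (allWords k n))

-- |S ∩ F| where F is the one-dimensional face of direction i through a
faceCount : ∀ {k n} → Subset k n → Fin n → Word k n → ℕ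
faceCount {k} S i a = length (filterᵇ (λ x → S (a [ i ]≔ x)) (allFin k))

IsLatinBitrade : ∀ {k n} → Subset k n → Set
IsLatinBitrade {k} {n} B =
  (i : Fin n) (a : Word k n) → (faceCount B i a ≡ 0) ⊎ (faceCount B i a ≡ 2)

IsMDS : ∀ {k n} → ℕ → Subset k n → Set
IsMDS {k} {n} t W = (i : Fin n) (a : Word k n) → faceCount W i a ≡ t

_△_ : ∀ {k n} → Subset k n → Subset k n → Subset k n
(S △ T) w = S w xor T w

module Submission where

open import Defs
open import Data.Nat using (ℕ; suc; _≤_; _+_; _∸_; _^_)
open import Data.Product using (Σ; _×_)
open import Relation.Binary.PropositionalEquality using (_≡_)

open import Algebra.Bundles using (CommutativeMonoid)
open import Data.Bool using (Bool; true; false; _∧_; _xor_)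
open import Data.Bool.Properties
  using (∧-comm; ∧-assoc; xor-comm; xor-assoc; ∧-distribˡ-xor; xor-annihilates-not; ∧-commutativeMonoid)
open import Data.Fin using (Fin; zero; suc)
open import Data.List using (List; []; _∷_; _++_; map; length; filterᵇ; allFin; concatMap)
open import Data.Nat using (zero; _*_; z≤n; s≤s)
open import Data.Nat.Properties using (+-comm; +-suc; +-identityʳ; *-distribˡ-+; ^-zeroˡ; m+n∸n≡m; <⇒≤)
open import Data.Product using (_,_; Σ-syntax)
open import Data.Sum using (_⊎_; inj₁; inj₂)
open import Data.Vec using ([]; _∷_; _[_]≔_)
open import Data.Nat.Tactic.RingSolver using (solve-∀)
open import Function using (_∘_)
open import Relation.Binary.PropositionalEquality using (refl; sym; trans; cong; cong₂; _≗_; module ≡-Reasoning)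

open import Algebra.Properties.CommutativeSemigroup
  (CommutativeMonoid.commutativeSemigroup ∧-commutativeMonoid) using (interchange)

-- The words whose letters have an odd number of entries in τ⁻¹(1) = {1, 2}
-- form a two-fold MDS code T.  Flipping T on a set S that meets every
-- one-dimensional face in ∅, {0, 1} or {0, 2} keeps it two-fold MDS, since
-- {1, 2} △ {0, 1} and {1, 2} △ {0, 2} again have two points; and for two such
-- sets (T △ S) △ (T △ S′) = S △ S′ meets every face in ∅, {0,1}, {0,2} or {1,2}.
-- Taking S = {0,2}ᵏ × {0,1}ⁿ⁻ᵏ and S′ = {0,2}ⁿ gives
-- |S △ S′| = |S| + |S′| − 2|S ∩ S′| = 2ⁿ + 2ⁿ − 2·2ᵏ.

private
  variable
    X : Set
    q n : ℕ

infixr 25 _∩_ _⊗_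
infix 30 _^⊗_

_∩_ : (X → Bool) → (X → Bool) → X → Bool
(P ∩ Q) x = P x ∧ Q x

count : (X → Bool) → List X → ℕ
count P xs = length (filterᵇ P xs)

count-cong : {P Q : X → Bool} → P ≗ Q → (xs : List X) → count P xs ≡ count Q xs
count-cong P≗Q [] = refl
count-cong {P = P} {Q} P≗Q (x ∷ xs) with P x | Q x | P≗Q x
... | true  | true  | refl = cong suc (count-cong P≗Q xs)
... | false | false | refl = count-cong P≗Q xs

count-++ : (P : X → Bool) (xs ys : List X) → count P (xs ++ ys) ≡ count P xs + count P ys
count-++ P [] ys = refl
count-++ P (x ∷ xs) ys with P x
... | true  = cong suc (count-++ P xs ys)
... | false = count-++ P xs ys

count-map : {Y : Set} (P : Y → Bool) (f : X → Y) (xs : List X) → count P (map f xs) ≡ count (P ∘ f) xs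
count-map P f [] = refl
count-map P f (x ∷ xs) with P (f x)
... | true  = cong suc (count-map P f xs)
... | false = count-map P f xs

count-false : (xs : List X) → count (λ _ → false) xs ≡ 0
count-false [] = refl
count-false (x ∷ xs) = count-false xs

_⊗_ : (Fin q → Bool) → Subset q n → Subset q (suc n)
(A ⊗ S) (x ∷ w) = A x ∧ S w

size : ∀ {q} → (Fin q → Bool) → ℕ
size {q} A = count A (allFin q)

card-cong : ∀ {q n} {S T : Subset q n} → S ≗ T → card S ≡ card T
card-cong {q} {n} S≗T = count-cong S≗T (allWords q n)

card-⊗ : ∀ {q n} (A : Fin q → Bool) (S : Subset q n) → card (A ⊗ S) ≡ size A * card S
card-⊗ {q} {n} A S = go (allFin q)
  where
  words = allWords q n

  go : (xs : List (Fin q)) →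
    count (A ⊗ S) (concatMap (λ x → map (x ∷_) words) xs) ≡ count A xs * card S
  go [] = refl
  go (x ∷ xs) = begin
    count (A ⊗ S) (map (x ∷_) words ++ concatMap (λ x → map (x ∷_) words) xs)
      ≡⟨ count-++ (A ⊗ S) (map (x ∷_) words) _ ⟩
    count (A ⊗ S) (map (x ∷_) words) + count (A ⊗ S) (concatMap (λ x → map (x ∷_) words) xs)
      ≡⟨ cong₂ _+_ (count-map (A ⊗ S) (x ∷_) words) (go xs) ⟩
    count (λ w → A x ∧ S w) words + count A xs * card S
      ≡⟨ first-letter ⟩
    count A (x ∷ xs) * card S ∎
    where
    open ≡-Reasoning
    first-letter : count (λ w → A x ∧ S w) words + count A xs * card S ≡ count A (x ∷ xs) * card S
    first-letter with A x
    ... | true  = refl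
    ... | false = cong (_+ count A xs * card S) (count-false words)

count-△ : (P Q : X → Bool) (xs : List X) →
  count (λ x → P x xor Q x) xs + 2 * count (P ∩ Q) xs ≡ count P xs + count Q xs
count-△ P Q [] = refl
count-△ P Q (x ∷ xs) with P x | Q x | count-△ P Q xs
... | true  | true  | ih = trans (two-more _ _) (cong suc (trans (cong suc ih) (sym (+-suc _ _))))
  where
  two-more : ∀ a b → a + 2 * suc b ≡ suc (suc (a + 2 * b))
  two-more = solve-∀
... | true  | false | ih = cong suc ih
... | false | true  | ih = trans (cong suc ih) (sym (+-suc _ _))
... | false | false | ih = ih

card-△ : ∀ {q n} (S T : Subset q n) → card (S △ T) + 2 * card (S ∩ T) ≡ card S + card T
card-△ {q} {n} S T = count-△ S T (allWords q n)

_^⊗_ : ∀ {q} → (Fin q → Bool) → (n : ℕ) → Subset q n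
A ^⊗ zero  = λ _ → true
A ^⊗ suc n = A ⊗ (A ^⊗ n)

-- cube k A B = Aᵏ × Bⁿ⁻ᵏ, and Aⁿ when k ≥ n.
cube : ∀ {q n} → ℕ → (Fin q → Bool) → (Fin q → Bool) → Subset q n
cube {n = n}     zero    A B = B ^⊗ n
cube {n = zero}  (suc k) A B = λ _ → true
cube {n = suc n} (suc k) A B = A ⊗ cube k A B

card-^⊗ : ∀ {q} (A : Fin q → Bool) n → card (A ^⊗ n) ≡ size A ^ n
card-^⊗ A zero    = refl
card-^⊗ A (suc n) = trans (card-⊗ A (A ^⊗ n)) (cong (size A *_) (card-^⊗ A n))

^⊗-∩ : ∀ {q} (A B : Fin q → Bool) n → (A ^⊗ n) ∩ (B ^⊗ n) ≗ (A ∩ B) ^⊗ n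
^⊗-∩ A B zero    []      = refl
^⊗-∩ A B (suc n) (x ∷ w) =
  trans (interchange (A x) ((A ^⊗ n) w) (B x) ((B ^⊗ n) w)) (cong ((A x ∧ B x) ∧_) (^⊗-∩ A B n w))

⊗-△ : ∀ {q n} (A : Fin q → Bool) (S T : Subset q n) → (A ⊗ S) △ (A ⊗ T) ≗ A ⊗ (S △ T)
⊗-△ A S T (x ∷ w) = sym (∧-distribˡ-xor (A x) (S w) (T w))

pair : Bool → Fin 4 → Bool
pair _     zero                   = true
pair true  (suc zero)             = true
pair false (suc zero)             = false
pair true  (suc (suc zero))       = false
pair false (suc (suc zero))       = true
pair _     (suc (suc (suc zero))) = false

τ : Fin 4 → Bool
τ zero                   = false
τ (suc zero)             = true
τ (suc (suc zero))       = true
τ (suc (suc (suc zero))) = false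

card-pair-△ : ∀ n → card ((pair true ^⊗ n) △ (pair false ^⊗ n)) + 2 ≡ 2 ^ suc n
card-pair-△ n = begin
  card (E △ F) + 2                ≡⟨ cong (λ m → card (E △ F) + 2 * m) (sym card-E∩F) ⟩
  card (E △ F) + 2 * card (E ∩ F) ≡⟨ card-△ E F ⟩
  card E + card F                 ≡⟨ cong₂ _+_ (card-^⊗ (pair true) n) (card-^⊗ (pair false) n) ⟩
  2 ^ n + 2 ^ n                   ≡⟨ cong (2 ^ n +_) (sym (+-identityʳ (2 ^ n))) ⟩
  2 ^ suc n                       ∎
  where
  open ≡-Reasoning
  E F : Subset 4 n
  E = pair true ^⊗ n
  F = pair false ^⊗ n
  card-E∩F : card (E ∩ F) ≡ 1
  card-E∩F = trans (card-cong (^⊗-∩ (pair true) (pair false) n)) (trans (card-^⊗ _ n) (^-zeroˡ n))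

card-cube-△ : ∀ {k n} → k ≤ n →
  card {n = n} (cube k (pair false) (pair true) △ cube k (pair false) (pair false)) + 2 ^ suc k ≡ 2 ^ suc n
card-cube-△ {zero}  {n}     z≤n       = card-pair-△ n
card-cube-△ {suc k} {suc n} (s≤s k≤n) = begin
  card (F ⊗ C E △ F ⊗ C F) + 2 * 2 ^ suc k     ≡⟨ cong (_+ 2 * 2 ^ suc k) (card-cong (⊗-△ F (C E) (C F))) ⟩
  card (F ⊗ (C E △ C F)) + 2 * 2 ^ suc k       ≡⟨ cong (_+ 2 * 2 ^ suc k) (card-⊗ F (C E △ C F)) ⟩
  2 * card (C E △ C F) + 2 * 2 ^ suc k         ≡⟨ sym (*-distribˡ-+ 2 (card (C E △ C F)) (2 ^ suc k)) ⟩
  2 * (card (C E △ C F) + 2 ^ suc k)           ≡⟨ cong (2 *_) (card-cube-△ k≤n) ⟩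
  2 * 2 ^ suc n                                ∎
  where
  open ≡-Reasoning
  F E : Fin 4 → Bool
  F = pair false
  E = pair true
  C : (Fin 4 → Bool) → Subset 4 n
  C = cube k F

restrict : ∀ {q n} → Subset q n → Fin n → Word q n → Fin q → Bool
restrict S i a x = S (a [ i ]≔ x)

PairFaced : ∀ {n} → Subset 4 n → Set
PairFaced S = ∀ i a → Σ[ c ∈ Bool ] Σ[ s ∈ Bool ] restrict S i a ≗ λ x → c ∧ pair s x

pairFaced-⊗ : ∀ {n} {S : Subset 4 n} s → PairFaced S → PairFaced (pair s ⊗ S)
pairFaced-⊗ {S = S} s _ zero (_ ∷ w) = S w , s , λ x → ∧-comm (pair s x) (S w)
pairFaced-⊗ s S-faced (suc i) (y ∷ w) with S-faced i w
... | c , t , eq = pair s y ∧ c , t , λ x → trans (cong (pair s y ∧_) (eq x)) (sym (∧-assoc (pair s y) c (pair t x)))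

pairFaced-^⊗ : ∀ s n → PairFaced (pair s ^⊗ n)
pairFaced-^⊗ s zero    = λ ()
pairFaced-^⊗ s (suc n) = pairFaced-⊗ s (pairFaced-^⊗ s n)

pairFaced-cube : ∀ k s t n → PairFaced {n} (cube k (pair s) (pair t))
pairFaced-cube zero    s t n       = pairFaced-^⊗ t n
pairFaced-cube (suc k) s t zero    = λ ()
pairFaced-cube (suc k) s t (suc n) = pairFaced-⊗ s (pairFaced-cube k s t n)

parityCode : ∀ {n} → Subset 4 n
parityCode []      = false
parityCode (x ∷ w) = τ x xor parityCode w

restrict-parityCode : ∀ {n} i (a : Word 4 n) → Σ[ c ∈ Bool ] restrict parityCode i a ≗ λ x → c xor τ x
restrict-parityCode zero    (_ ∷ w) = parityCode w , λ x → xor-comm (τ x) (parityCode w)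
restrict-parityCode (suc i) (y ∷ w) with restrict-parityCode i w
... | c , eq = τ y xor c , λ x → trans (cong (τ y xor_) (eq x)) (sym (xor-assoc (τ y) c (τ x)))

size-τ-△-pair : ∀ c d s → size (λ x → (c xor τ x) xor (d ∧ pair s x)) ≡ 2
size-τ-△-pair false false s     = refl
size-τ-△-pair false true  false = refl
size-τ-△-pair false true  true  = refl
size-τ-△-pair true  false s     = refl
size-τ-△-pair true  true  false = refl
size-τ-△-pair true  true  true  = refl

size-pair-△-pair : ∀ c s d t → let P = λ x → (c ∧ pair s x) xor (d ∧ pair t x) in size P ≡ 0 ⊎ size P ≡ 2
size-pair-△-pair false s     false t     = inj₁ refl
size-pair-△-pair false s     true  false = inj₂ refl
size-pair-△-pair false s     true  true  = inj₂ refl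
size-pair-△-pair true  false false t     = inj₂ refl
size-pair-△-pair true  true  false t     = inj₂ refl
size-pair-△-pair true  false true  false = inj₁ refl
size-pair-△-pair true  false true  true  = inj₂ refl
size-pair-△-pair true  true  true  false = inj₂ refl
size-pair-△-pair true  true  true  true  = inj₁ refl

isMDS-parityCode-△ : ∀ {n} {S : Subset 4 n} → PairFaced S → IsMDS 2 (parityCode △ S)
isMDS-parityCode-△ S-faced i a with restrict-parityCode i a | S-faced i a
... | c , eq | d , s , eq′ =
  trans (count-cong (λ x → cong₂ _xor_ (eq x) (eq′ x)) (allFin 4)) (size-τ-△-pair c d s)

isLatinBitrade-△ : ∀ {n} {S T : Subset 4 n} → PairFaced S → PairFaced T → IsLatinBitrade (S △ T)
isLatinBitrade-△ S-faced T-faced i a with S-faced i a | T-faced i a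
... | c , s , eq | d , t , eq′
  rewrite count-cong (λ x → cong₂ _xor_ (eq x) (eq′ x)) (allFin 4) = size-pair-△-pair c s d t

△-cancelˡ : ∀ {q n} (T S S′ : Subset q n) → (T △ S) △ (T △ S′) ≗ S △ S′
△-cancelˡ T S S′ w with T w
... | false = refl
... | true  = xor-annihilates-not (S w) (S′ w)

proposition11 : (n s : ℕ) → 1 ≤ n → 1 ≤ s → s ≤ n →
    Σ (Subset 4 n) λ M → Σ (Subset 4 n) λ B →
      IsMDS 2 M × IsLatinBitrade B × (card B ≡ 2 ^ (n + 1) ∸ 2 ^ s) ×
      Σ (Subset 4 n) λ M′ → IsMDS 2 M′ × ((w : Word 4 n) → B w ≡ (M △ M′) w)
proposition11 n (suc k) _ _ k<n =
  parityCode △ S true , S true △ S false , isMDS-parityCode-△ {S = S true} (faced true) ,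
  isLatinBitrade-△ {S = S true} {S false} (faced true) (faced false) , card-B ,
  parityCode △ S false , isMDS-parityCode-△ {S = S false} (faced false) ,
  λ w → sym (△-cancelˡ parityCode (S true) (S false) w)
  where
  open ≡-Reasoning
  S : Bool → Subset 4 n
  S s = cube k (pair false) (pair s)
  faced : ∀ s → PairFaced (S s)
  faced s = pairFaced-cube k false s n
  card-B : card (S true △ S false) ≡ 2 ^ (n + 1) ∸ 2 ^ suc k
  card-B = begin
    card (S true △ S false)                       ≡⟨ sym (m+n∸n≡m _ (2 ^ suc k)) ⟩
    card (S true △ S false) + 2 ^ suc k ∸ 2 ^ suc k ≡⟨ cong (_∸ 2 ^ suc k) (card-cube-△ (<⇒≤ k<n)) ⟩
    2 ^ suc n ∸ 2 ^ suc k                         ≡⟨ cong (λ m → 2 ^ m ∸ 2 ^ suc k) (+-comm 1 n) ⟩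
    2 ^ (n + 1) ∸ 2 ^ suc k                       ∎
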